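{- Let $m,n,W$ be positive integers with $W\mid m$, let $\lambda\ge 2$ be an integer with $\lambda\mid W$, let $r\in[n]$, and let $\rho$ be the $(\lambda,r)$-densifying map. Then for every $U\subseteq[m]^n$ that does not depend on coordinate $r$, the map $\rho$ maps the set $\{x\in U: (\mathrm{wt}(x)\bmod W)\in[0,W/\lambda)\}$ bijectively onto the set $\{x\in U: x_r/m\in[0,1/\lambda)\}$.
   Context: $[a]=\{0,1,\dots,a-1\}$; $\mathrm{wt}(x)=\sum_{j\in[n]}x_j$. A set $U\subseteq[m]^n$ does not depend on coordinate $r$ if for every $x\in U$ and every $y\in[m]$, replacing the $r$-th coordinate of $x$ by $y$ yields an element of $U$. The $(\lambda,r)$-densifying map $\rho:[m]^n\to[m]^n$ is defined as follows: for $x\in[m]^n$ write $x_r=aW+b\,W/\lambda+c$ with $a\in\{0,\dots,m/W-1\}$, $b\in\{0,\dots,\lambda-1\}$, $c\in\{0,\dots,W/\lambda-1\}$; then $(\rho(x))_r=aW/\lambda+c$ and $(\rho(x))_j=x_j$ for $j\ne r$. -}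

module Defs where

open import Data.Nat using (ℕ; zero; suc; _+_; _*_; _<_)
open import Data.Nat.DivMod using (_/_; _%_)
open import Data.Fin using (Fin)
open import Data.Vec using (Vec; lookup; updateAt; _[_]≔_; sum)
open import Data.Product using (_×_; ∃)
open import Relation.Binary.PropositionalEquality using (_≡_)

-- Total division / remainder on ℕ (convention: x div 0 = 0, x mod 0 = x).
-- Only ever used with nonzero divisors under the theorem's hypotheses.
_div_ : ℕ → ℕ → ℕ
x div zero    = 0
x div (suc k) = x / suc k

_mod_ : ℕ → ℕ → ℕ
x mod zero    = x
x mod (suc k) = x % suc k

InCube : (m : ℕ) {n : ℕ} → Vec ℕ n → Set
InCube m x = ∀ j → lookup x j < m

wt : {n : ℕ} → Vec ℕ n → ℕ
wt = sum

DoesNotDependOn : (m : ℕ) {n : ℕ} → (Vec ℕ n → Set) → Fin n → Set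
DoesNotDependOn m U r = ∀ x → U x → ∀ y → y < m → U (x [ r ]≔ y)

-- x_r = a W + b (W/λ) + c  with  a = x_r div W, b = (x_r mod W) div (W/λ),
-- c = (x_r mod W) mod (W/λ);  new coordinate = a (W/λ) + c.
densifyCoord : (W λ' : ℕ) → ℕ → ℕ
densifyCoord W λ' t = (t div W) * (W div λ') + ((t mod W) mod (W div λ'))

densify : (W λ' : ℕ) {n : ℕ} → Fin n → Vec ℕ n → Vec ℕ n
densify W λ' r x = updateAt x r (densifyCoord W λ')

BijOnto : {X Y : Set} → (X → Y) → (X → Set) → (Y → Set) → Set
BijOnto {X} f A B =
  (∀ x → A x → B (f x)) ×
  (∀ x y → A x → A y → f x ≡ f y → x ≡ y) ×
  (∀ y → B y → ∃ λ x → A x × f x ≡ y)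

-- Write t = c + q w with c < w = W/λ, and q = b + a λ with b < λ.  The densifying map sends t to
-- c + a w, forgetting the middle digit b, while (S + t) mod W < w holds iff λ ∣ (c + S)/w + q,
-- i.e. iff b is the unique residue mod λ fixed by c and the weight S of the other coordinates.
-- So on each fibre of the forgetful map exactly one t satisfies the weight condition.
module Submission where

open import Defs
open import Data.Nat using (ℕ; _*_; _<_; _≤_)
open import Data.Nat.Divisibility using (_∣_)
open import Data.Fin using (Fin)
open import Data.Vec using (Vec; lookup)
open import Data.Product using (_×_)

open import Data.Fin using (zero; suc)
open import Data.Nat using (suc; _+_; _∸_; NonZero; >-nonZero; z<s)
open import Data.Nat.DivMod hiding (_div_; _mod_)
open import Data.Nat.Divisibility using (divides; n∣m*n; m∣m*n)
open import Data.Nat.Properties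
open import Algebra.Properties.CommutativeSemigroup +-commutativeSemigroup using (x∙yz≈y∙xz; xy∙z≈xz∙y)
open import Data.Product using (_,_; proj₁; proj₂; ∃)
open import Data.Vec using (_∷_; updateAt; _[_]≔_; sum)
open import Data.Vec.Properties using (updateAt-updateAt; updateAt-cong-local; lookup∘updateAt; []≔-lookup)
open import Function using (id)
open import Relation.Binary.PropositionalEquality
open import Relation.Unary using (_≐_)

BijOnto-respˡ : {X Y : Set} {f : X → Y} {A A′ : X → Set} {B : Y → Set} →
                A ≐ A′ → BijOnto f A B → BijOnto f A′ B
BijOnto-respˡ (A⊆A′ , A′⊆A) (maps , injective , onto) =
  (λ x a → maps x (A′⊆A a)) ,
  (λ x y a b → injective x y (A′⊆A a) (A′⊆A b)) ,
  (λ y b → let x , a , fx≡y = onto y b in x , A⊆A′ a , fx≡y)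

×-≐ : {X : Set} {R P Q : X → Set} → (∀ {x} → P x ≡ Q x) → (λ x → R x × P x) ≐ (λ x → R x × Q x)
×-≐ P≡Q = (λ (r , p) → r , subst id P≡Q p) , (λ (r , q) → r , subst id (sym P≡Q) q)

div≡/ : ∀ m n .{{_ : NonZero n}} → m div n ≡ m / n
div≡/ m (suc n) = refl

mod≡% : ∀ m n .{{_ : NonZero n}} → m mod n ≡ m % n
mod≡% m (suc n) = refl

+-*-< : ∀ {c w q k} → c < w → q < k → c + q * w < k * w
+-*-< {c} {w} {q} {k} c<w q<k = begin-strict
  c + q * w  <⟨ +-monoˡ-< (q * w) c<w ⟩
  suc q * w  ≤⟨ *-monoˡ-≤ w q<k ⟩
  k * w      ∎
  where open ≤-Reasoning

module _ {n : ℕ} .{{_ : NonZero n}} where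

  [m+kn]/n≡k : ∀ {m} k → m < n → (m + k * n) / n ≡ k
  [m+kn]/n≡k {m} k m<n = begin
    (m + k * n) / n    ≡⟨ +-distrib-/-∣ʳ m (n∣m*n k) ⟩
    m / n + k * n / n  ≡⟨ cong₂ _+_ (m<n⇒m/n≡0 m<n) (m*n/n≡m k n) ⟩
    k                  ∎
    where open ≡-Reasoning

  [m+kn]%n≡m : ∀ {m} k → m < n → (m + k * n) % n ≡ m
  [m+kn]%n≡m {m} k m<n = trans ([m+kn]%n≡m%n m k n) (m<n⇒m%n≡m m<n)

  [m+o%n]%n≡[m+o]%n : ∀ m o → (m + o % n) % n ≡ (m + o) % n
  [m+o%n]%n≡[m+o]%n m o = begin
    (m + o % n) % n          ≡⟨ %-distribˡ-+ m (o % n) n ⟩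
    (m % n + o % n % n) % n  ≡⟨ cong (λ v → (m % n + v) % n) (m%n%n≡m%n o n) ⟩
    (m % n + o % n) % n      ≡⟨ %-distribˡ-+ m o n ⟨
    (m + o) % n              ∎
    where open ≡-Reasoning

  [m+o]/n≡[m%n+o]/n+m/n : ∀ m o → (m + o) / n ≡ (m % n + o) / n + m / n
  [m+o]/n≡[m%n+o]/n+m/n m o = begin
    (m + o) / n                     ≡⟨ /-congˡ (cong (_+ o) (m≡m%n+[m/n]*n m n)) ⟩
    (m % n + m / n * n + o) / n     ≡⟨ /-congˡ (xy∙z≈xz∙y (m % n) (m / n * n) o) ⟩
    (m % n + o + m / n * n) / n     ≡⟨ +-distrib-/-∣ʳ (m % n + o) (n∣m*n (m / n)) ⟩
    (m % n + o) / n + m / n * n / n ≡⟨ cong ((m % n + o) / n +_) (m*n/n≡m (m / n) n) ⟩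
    (m % n + o) / n + m / n         ∎
    where open ≡-Reasoning

  %-/-injective : ∀ {m o} → m % n ≡ o % n → m / n ≡ o / n → m ≡ o
  %-/-injective {m} {o} m%n≡o%n m/n≡o/n = begin
    m                  ≡⟨ m≡m%n+[m/n]*n m n ⟩
    m % n + m / n * n  ≡⟨ cong₂ (λ r q → r + q * n) m%n≡o%n m/n≡o/n ⟩
    o % n + o / n * n  ≡⟨ m≡m%n+[m/n]*n o n ⟨
    o                  ∎
    where open ≡-Reasoning

module _ {l : ℕ} .{{_ : NonZero l}} where

  residue-forced : ∀ K {q} → (K + q) % l ≡ 0 → q % l ≡ K * (l ∸ 1) % l
  residue-forced K {q} l∣K+q = begin
    q % l                           ≡⟨ %-remove-+ˡ q (n∣m*n K) ⟨
    (K * l + q) % l                 ≡⟨ cong (λ v → (v + q) % l) K*l≡K*[l∸1]+K ⟩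
    (K * (l ∸ 1) + K + q) % l       ≡⟨ cong (_% l) (+-assoc (K * (l ∸ 1)) K q) ⟩
    (K * (l ∸ 1) + (K + q)) % l     ≡⟨ [m+o%n]%n≡[m+o]%n (K * (l ∸ 1)) (K + q) ⟨
    (K * (l ∸ 1) + (K + q) % l) % l ≡⟨ cong (λ v → (K * (l ∸ 1) + v) % l) l∣K+q ⟩
    (K * (l ∸ 1) + 0) % l           ≡⟨ cong (_% l) (+-identityʳ (K * (l ∸ 1))) ⟩
    K * (l ∸ 1) % l                 ∎
    where
    open ≡-Reasoning
    K*l≡K*[l∸1]+K : K * l ≡ K * (l ∸ 1) + K
    K*l≡K*[l∸1]+K = trans (cong (K *_) (sym (suc-pred l))) (trans (*-suc K (l ∸ 1)) (+-comm K _))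

  -- Each block [a l, a l + l) contains exactly one q with l ∣ K + q; this is it.
  blockRep : ℕ → ℕ → ℕ
  blockRep K a = K * (l ∸ 1) % l + a * l

  blockRep-/ : ∀ K a → blockRep K a / l ≡ a
  blockRep-/ K a = [m+kn]/n≡k a (m%n<n (K * (l ∸ 1)) l)

  blockRep-∣ : ∀ K a → (K + blockRep K a) % l ≡ 0
  blockRep-∣ K a = begin
    (K + (K * (l ∸ 1) % l + a * l)) % l  ≡⟨ cong (_% l) (+-assoc K _ (a * l)) ⟨
    (K + K * (l ∸ 1) % l + a * l) % l    ≡⟨ [m+kn]%n≡m%n (K + K * (l ∸ 1) % l) a l ⟩
    (K + K * (l ∸ 1) % l) % l            ≡⟨ [m+o%n]%n≡[m+o]%n K (K * (l ∸ 1)) ⟩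
    (K + K * (l ∸ 1)) % l                ≡⟨ cong (_% l) (*-suc K (l ∸ 1)) ⟨
    K * suc (l ∸ 1) % l                  ≡⟨ cong (λ v → K * v % l) (suc-pred l) ⟩
    K * l % l                            ≡⟨ m*n%n≡0 K l ⟩
    0                                    ∎
    where open ≡-Reasoning

  block-unique : ∀ K {q q′} → (K + q) % l ≡ 0 → (K + q′) % l ≡ 0 → q / l ≡ q′ / l → q ≡ q′
  block-unique K l∣K+q l∣K+q′ = %-/-injective (trans (residue-forced K l∣K+q) (sym (residue-forced K l∣K+q′)))

sum-[]≔ : ∀ {n} (x : Vec ℕ n) (r : Fin n) t → sum (x [ r ]≔ t) ≡ t + sum (x [ r ]≔ 0)
sum-[]≔ (a ∷ x) zero    t = refl
sum-[]≔ (a ∷ x) (suc r) t = trans (cong (a +_) (sum-[]≔ x r t)) (x∙yz≈y∙xz a t _)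

module _ (w l : ℕ) {{_ : NonZero w}} {{_ : NonZero l}} where

  private
    W = w * l

    instance
      W≢0 : NonZero W
      W≢0 = m*n≢0 w l

      lw≢0 : NonZero (l * w)
      lw≢0 = m*n≢0 l w

  W/l≡w : W div l ≡ w
  W/l≡w = trans (div≡/ W l) (m*n/n≡m w l)

  densifyCoord≡ : ∀ t → densifyCoord W l t ≡ t % w + t / w / l * w
  densifyCoord≡ t = begin
    (t div W) * (W div l) + ((t mod W) mod (W div l)) ≡⟨ cong (λ v → (t div W) * v + ((t mod W) mod v)) W/l≡w ⟩
    (t div W) * w + ((t mod W) mod w)                 ≡⟨ cong₂ (λ a c → a * w + c) (div≡/ t W) (mod≡% (t mod W) w) ⟩
    t / W * w + (t mod W) % w                         ≡⟨ cong₂ (λ a c → a * w + c % w) (sym (m/n/o≡m/[n*o] t w l)) (mod≡% t W) ⟩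
    t / w / l * w + t % W % w                         ≡⟨ cong (t / w / l * w +_) (m∣n⇒o%n%m≡o%m w W t (m∣m*n l)) ⟩
    t / w / l * w + t % w                             ≡⟨ +-comm (t / w / l * w) (t % w) ⟩
    t % w + t / w / l * w                             ∎
    where open ≡-Reasoning

  %W/w≡ : ∀ S t → (t + S) % W / w ≡ ((t % w + S) / w + t / w) % l
  %W/w≡ S t = begin
    (t + S) % W / w                ≡⟨ /-congˡ (%-congʳ (*-comm w l)) ⟩
    (t + S) % (l * w) / w          ≡⟨ m%[n*o]/o≡m/o%n (t + S) l w ⟩
    (t + S) / w % l                ≡⟨ %-congˡ ([m+o]/n≡[m%n+o]/n+m/n {w} t S) ⟩
    ((t % w + S) / w + t / w) % l  ∎
    where open ≡-Reasoning

  wt-[]≔-condition : ∀ {n} (z : Vec ℕ n) r t →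
                     ((t + sum (z [ r ]≔ 0)) % W < w) ≡ (wt (z [ r ]≔ t) mod W < W div l)
  wt-[]≔-condition z r t = sym (cong₂ _<_ (trans (mod≡% _ W) (%-congˡ (sum-[]≔ z r t))) W/l≡w)

  %W<w⇒∣ : ∀ S t → (t + S) % W < w → ((t % w + S) / w + t / w) % l ≡ 0
  %W<w⇒∣ S t lt = trans (sym (%W/w≡ S t)) (m<n⇒m/n≡0 lt)

  ∣⇒%W<w : ∀ S t → ((t % w + S) / w + t / w) % l ≡ 0 → (t + S) % W < w
  ∣⇒%W<w S t eq = m/n≡0⇒m<n (trans (%W/w≡ S t) eq)

  module _ (k : ℕ) where

    *l<k*W⇒<k*w : ∀ {y} → y * l < k * W → y < k * w
    *l<k*W⇒<k*w {y} lt = *-cancelʳ-< l y (k * w) (subst (y * l <_) (sym (*-assoc k w l)) lt)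

    <k*w⇒*l<k*W : ∀ {y} → y < k * w → y * l < k * W
    <k*w⇒*l<k*W {y} lt = subst (y * l <_) (*-assoc k w l) (*-monoˡ-< l lt)

    densifyCoord-maps : ∀ {t} → t < k * W → densifyCoord W l t * l < k * W
    densifyCoord-maps {t} t<kW = <k*w⇒*l<k*W (subst (_< k * w) (sym (densifyCoord≡ t)) (+-*-< (m%n<n t w) t/w/l<k))
      where
      t/w/l<k : t / w / l < k
      t/w/l<k = subst (_< k) (sym (m/n/o≡m/[n*o] t w l)) (m<n*o⇒m/o<n t<kW)

    densifyCoord-injective : ∀ S {t t′} → (t + S) % W < w → (t′ + S) % W < w →
                             densifyCoord W l t ≡ densifyCoord W l t′ → t ≡ t′
    densifyCoord-injective S {t} {t′} good good′ eq = %-/-injective low≡ mid≡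
      where
      eq′ : t % w + t / w / l * w ≡ t′ % w + t′ / w / l * w
      eq′ = trans (sym (densifyCoord≡ t)) (trans eq (densifyCoord≡ t′))
      low≡ : t % w ≡ t′ % w
      low≡ = trans (sym ([m+kn]%n≡m (t / w / l) (m%n<n t w)))
                   (trans (%-congˡ eq′) ([m+kn]%n≡m (t′ / w / l) (m%n<n t′ w)))
      high≡ : t / w / l ≡ t′ / w / l
      high≡ = trans (sym ([m+kn]/n≡k (t / w / l) (m%n<n t w)))
                    (trans (/-congˡ eq′) ([m+kn]/n≡k (t′ / w / l) (m%n<n t′ w)))
      mid≡ : t / w ≡ t′ / w
      mid≡ = block-unique ((t % w + S) / w) (%W<w⇒∣ S t good)
               (subst (λ c → ((c + S) / w + t′ / w) % l ≡ 0) (sym low≡) (%W<w⇒∣ S t′ good′)) high≡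

    densifyCoord-onto : ∀ S {y} → y < k * w → ∃ λ t → (t < k * W × (t + S) % W < w) × densifyCoord W l t ≡ y
    densifyCoord-onto S {y} y<kw = t , (t<kW , ∣⇒%W<w S t t∣) , densify-t
      where
      c = y % w
      a = y / w
      K = (c + S) / w
      q = blockRep K a
      t = c + q * w
      t%w≡c : t % w ≡ c
      t%w≡c = [m+kn]%n≡m q (m%n<n y w)
      t/w≡q : t / w ≡ q
      t/w≡q = [m+kn]/n≡k q (m%n<n y w)
      t<kW : t < k * W
      t<kW = subst (t <_) (trans (*-assoc k l w) (cong (k *_) (*-comm l w)))
               (+-*-< {k = k * l} (m%n<n y w) (+-*-< {k = k} (m%n<n (K * (l ∸ 1)) l) (m<n*o⇒m/o<n y<kw)))
      t∣ : ((t % w + S) / w + t / w) % l ≡ 0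
      t∣ = subst₂ (λ c′ q′ → ((c′ + S) / w + q′) % l ≡ 0) (sym t%w≡c) (sym t/w≡q) (blockRep-∣ K a)
      densify-t : densifyCoord W l t ≡ y
      densify-t = begin
        densifyCoord W l t     ≡⟨ densifyCoord≡ t ⟩
        t % w + t / w / l * w  ≡⟨ cong₂ (λ c′ q′ → c′ + q′ / l * w) t%w≡c t/w≡q ⟩
        c + q / l * w          ≡⟨ cong (λ a′ → c + a′ * w) (blockRep-/ K a) ⟩
        c + a * w              ≡⟨ m≡m%n+[m/n]*n y w ⟨
        y                      ∎
        where open ≡-Reasoning

    densifyCoord-BijOnto : ∀ S → BijOnto (densifyCoord W l)
                             (λ t → t < k * W × (t + S) % W < w) (λ y → y * l < k * W)
    densifyCoord-BijOnto S =
      (λ t (t<kW , _) → densifyCoord-maps t<kW) ,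
      (λ t t′ (_ , good) (_ , good′) → densifyCoord-injective S good good′) ,
      (λ y lt → densifyCoord-onto S (*l<k*W⇒<k*w lt))

module _ {n m : ℕ} (r : Fin n) (f : ℕ → ℕ) {U A : Vec ℕ n → Set} {Q : ℕ → Set}
         (U⇒<m : ∀ x → U x → lookup x r < m) (indep : DoesNotDependOn m U r) (Q⇒<m : ∀ y → Q y → y < m) where

  updateAt-BijOnto : (∀ z → BijOnto f (λ t → t < m × A (z [ r ]≔ t)) Q) →
                     BijOnto (λ x → updateAt x r f) (λ x → U x × A x) (λ x → U x × Q (lookup x r))
  updateAt-BijOnto bij = maps , injective , onto
    where
    A-at : ∀ {x} → A x → A (x [ r ]≔ lookup x r)
    A-at {x} = subst A (sym ([]≔-lookup x r))

    maps : ∀ x → U x × A x → U (updateAt x r f) × Q (lookup (updateAt x r f) r)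
    maps x (Ux , Ax) = subst U (updateAt-cong-local r x refl) (indep x Ux (f (lookup x r)) (Q⇒<m _ Qfx)) ,
                       subst Q (sym (lookup∘updateAt r x)) Qfx
      where
      Qfx : Q (f (lookup x r))
      Qfx = proj₁ (bij x) (lookup x r) (U⇒<m x Ux , A-at Ax)

    injective : ∀ x y → U x × A x → U y × A y → updateAt x r f ≡ updateAt y r f → x ≡ y
    injective x y (Ux , Ax) (Uy , Ay) eq = begin
      x                   ≡⟨ []≔-lookup x r ⟨
      x [ r ]≔ lookup x r ≡⟨ cong (x [ r ]≔_) xr≡yr ⟩
      x [ r ]≔ lookup y r ≡⟨ agree (lookup y r) ⟩
      y [ r ]≔ lookup y r ≡⟨ []≔-lookup y r ⟩
      y                   ∎
      where
      open ≡-Reasoning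
      agree : ∀ v → x [ r ]≔ v ≡ y [ r ]≔ v
      agree v = trans (sym (updateAt-updateAt r x)) (trans (cong (_[ r ]≔ v) eq) (updateAt-updateAt r y))
      fxr≡fyr : f (lookup x r) ≡ f (lookup y r)
      fxr≡fyr = trans (sym (lookup∘updateAt r x)) (trans (cong (λ v → lookup v r) eq) (lookup∘updateAt r y))
      xr≡yr : lookup x r ≡ lookup y r
      xr≡yr = proj₁ (proj₂ (bij x)) (lookup x r) (lookup y r) (U⇒<m x Ux , A-at Ax)
                (U⇒<m y Uy , subst A (sym (trans (agree (lookup y r)) ([]≔-lookup y r))) Ay) fxr≡fyr

    onto : ∀ y → U y × Q (lookup y r) → ∃ λ x → (U x × A x) × updateAt x r f ≡ y
    onto y (Uy , Qy) with proj₂ (proj₂ (bij y)) (lookup y r) Qy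
    ... | t , (t<m , At) , ft≡yr = y [ r ]≔ t , (indep y Uy t t<m , At) , (begin
      updateAt (y [ r ]≔ t) r f  ≡⟨ updateAt-updateAt r y ⟩
      y [ r ]≔ f t               ≡⟨ cong (y [ r ]≔_) ft≡yr ⟩
      y [ r ]≔ lookup y r        ≡⟨ []≔-lookup y r ⟩
      y                          ∎)
      where open ≡-Reasoning

mainTheorem4 : (m n W λ' : ℕ) → 1 ≤ m → 1 ≤ n → 1 ≤ W → W ∣ m → 2 ≤ λ' → λ' ∣ W
    → (r : Fin n) → (U : Vec ℕ n → Set)
    → (∀ x → U x → InCube m x)
    → DoesNotDependOn m U r
    → BijOnto (densify W λ' r)
    (λ x → U x × (wt x mod W) < W div λ')
    (λ x → U x × lookup x r * λ' < m)
mainTheorem4 .(k * (w * l)) n .(w * l) l _ _ 0<W (divides k refl) 1<l (divides w refl) r U inCube indep =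
  updateAt-BijOnto r (densifyCoord (w * l) l) (λ x Ux → inCube x Ux r) indep (λ y lt → ≤-<-trans (m≤m*n y l) lt)
    (λ z → BijOnto-respˡ (×-≐ (wt-[]≔-condition w l z r _)) (densifyCoord-BijOnto w l k (sum (z [ r ]≔ 0))))
  where
  instance
    l≢0 : NonZero l
    l≢0 = >-nonZero (<-trans z<s 1<l)
    w≢0 : NonZero w
    w≢0 = m*n≢0⇒m≢0 w {{>-nonZero 0<W}}
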